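{- Let $p\geq 3$ be a prime number, let $m$ be an odd positive integer, and let $t$ be a positive integer. Define \[ \hat S(m,p^t):=1^{mp}+2^{mp}+\cdots+(p^t)^{mp},\qquad \hat S'(m,p^t):=1^{mp}+2^{mp}+\cdots+(p^t-1)^{mp}. \] Then $\hat S(m,p^t)\equiv 0\pmod{p^{t+1}}$ and $\hat S'(m,p^t)\equiv 0\pmod{p^{t+1}}$. -}

module Defs where

open import Data.Nat using (ℕ; zero; suc; _+_; _^_)

powSum : ℕ → ℕ → ℕ
powSum e zero    = 0
powSum e (suc n) = powSum e n + suc n ^ e

-- Let N = p^t and e = m p, which is odd.  If k + b = N then, expanding (N - b)^e
-- binomially, k^e + b^e ≡ e N b^(e-1) (mod N^2), and both e N and N^2 are divisible
-- by p N = p^(t+1).  Pairing k with N - k shows 2 Ŝ' ≡ 0 (mod p^(t+1)), and p is odd.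
-- Finally Ŝ = Ŝ' + N^e, where N^2 divides N^e.
module Submission where

open import Defs
open import Data.Nat using (ℕ; _*_; _∸_; _^_; _≤_; _+_)
open import Data.Nat.Divisibility using (_∣_)
open import Data.Nat.Primality using (Prime)
open import Relation.Nullary using (¬_)
open import Data.Product using (_×_)

open import Data.Nat using (zero; suc; s≤s; z≤n)
import Data.Nat.Properties as ℕ
open import Data.Nat.Divisibility
  using (divides; ∣-refl; ∣-trans; ∣m∣n⇒∣m+n; n∣m*n; m∣m*n; *-monoʳ-∣; ∣1⇒≡1)
open import Data.Nat.Coprimality using (Coprime; coprime-divisor)
open import Data.Nat.Primality using (euclidsLemma; prime[2]; ¬prime[1]; prime⇒nonZero; prime⇒irreducible; irreducible[2])
open import Data.Product using (∃-syntax; _,_)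
open import Data.Sum using (inj₁; inj₂)
open import Data.Integer as ℤ using (ℤ; +_; -_)
import Data.Integer.Properties as ℤ
open import Data.Integer.Divisibility.Signed as ℤ∣ using (∣ᵤ⇒∣; ∣⇒∣ᵤ)
import Data.Integer.Tactic.RingSolver as ℤ-Solver
import Data.Nat.Tactic.RingSolver as ℕ-Solver
open import Relation.Nullary using (contradiction)
open import Relation.Binary.PropositionalEquality
  using (_≡_; refl; sym; trans; cong; cong₂; subst; module ≡-Reasoning)

prime∤-* : ∀ {q m n} → Prime q → ¬ q ∣ m → ¬ q ∣ n → ¬ q ∣ m * n
prime∤-* {m = m} {n} pq q∤m q∤n q∣mn with euclidsLemma m n pq q∣mn
... | inj₁ q∣m = q∤m q∣m
... | inj₂ q∣n = q∤n q∣n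

prime∤-^ : ∀ {q m} → Prime q → ¬ q ∣ m → ∀ n → ¬ q ∣ m ^ n
prime∤-^ pq q∤m zero q∣1 with ∣1⇒≡1 q∣1
... | refl = ¬prime[1] pq
prime∤-^ pq q∤m (suc n) = prime∤-* pq q∤m (prime∤-^ pq q∤m n)

prime≥3⇒odd : ∀ {p} → Prime p → 3 ≤ p → ¬ 2 ∣ p
prime≥3⇒odd pp (s≤s (s≤s (s≤s z≤n))) 2∣p with prime⇒irreducible pp 2∣p
... | inj₁ ()
... | inj₂ ()

odd⇒coprime-2 : ∀ {d} → ¬ 2 ∣ d → Coprime d 2
odd⇒coprime-2 2∤d (i∣d , i∣2) with irreducible[2] i∣2
... | inj₁ i≡1 = i≡1
... | inj₂ refl = contradiction i∣d 2∤d

odd⇒≡suc-2* : ∀ n → ¬ 2 ∣ n → ∃[ j ] n ≡ suc (2 * j)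
odd⇒≡suc-2* zero          2∤0   = contradiction (divides 0 refl) 2∤0
odd⇒≡suc-2* (suc zero)    _     = 0 , refl
odd⇒≡suc-2* (suc (suc n)) 2∤2+n with odd⇒≡suc-2* n (λ 2∣n → 2∤2+n (∣m∣n⇒∣m+n ∣-refl 2∣n))
... | j , refl = suc j , cong suc (sym (ℕ.*-suc 2 j))

m*m∣m^n : ∀ m {n} → 2 ≤ n → m * m ∣ m ^ n
m*m∣m^n m {suc (suc n)} (s≤s (s≤s z≤n)) = *-monoʳ-∣ m (m∣m*n (m ^ n))

pos-^ : ∀ n e → + (n ^ e) ≡ (+ n) ℤ.^ e
pos-^ n zero    = refl
pos-^ n (suc e) = trans (ℤ.pos-* n (n ^ e)) (cong ((+ n) ℤ.*_) (pos-^ n e))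

neg-^-even : ∀ x j → (- x) ℤ.^ (2 * j) ≡ x ℤ.^ (2 * j)
neg-^-even x j = begin
  (- x) ℤ.^ (2 * j)     ≡⟨ ℤ.^-*-assoc (- x) 2 j ⟨
  ((- x) ℤ.^ 2) ℤ.^ j   ≡⟨ cong (ℤ._^ j) (neg-square x) ⟩
  (x ℤ.^ 2) ℤ.^ j       ≡⟨ ℤ.^-*-assoc x 2 j ⟩
  x ℤ.^ (2 * j)         ∎
  where
  open ≡-Reasoning
  neg-square : ∀ x → (- x) ℤ.* ((- x) ℤ.* + 1) ≡ x ℤ.* (x ℤ.* + 1)
  neg-square = ℤ-Solver.solve-∀

neg-^-odd : ∀ x j → (- x) ℤ.^ suc (2 * j) ≡ - (x ℤ.^ suc (2 * j))
neg-^-odd x j = begin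
  (- x) ℤ.* (- x) ℤ.^ (2 * j)  ≡⟨ cong ((- x) ℤ.*_) (neg-^-even x j) ⟩
  (- x) ℤ.* x ℤ.^ (2 * j)      ≡⟨ ℤ.neg-distribˡ-* x _ ⟨
  - (x ℤ.* x ℤ.^ (2 * j))      ∎
  where open ≡-Reasoning

binomial-mod-square : ∀ x d n →
  ∃[ q ] (x ℤ.+ d) ℤ.^ suc n ≡ x ℤ.^ suc n ℤ.+ (+ suc n) ℤ.* x ℤ.^ n ℤ.* d ℤ.+ q ℤ.* (d ℤ.* d)
binomial-mod-square x d zero = + 0 , base x d
  where
  base : ∀ x d → (x ℤ.+ d) ℤ.* + 1 ≡ x ℤ.* + 1 ℤ.+ + 1 ℤ.* + 1 ℤ.* d ℤ.+ + 0 ℤ.* (d ℤ.* d)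
  base = ℤ-Solver.solve-∀
binomial-mod-square x d (suc n) with binomial-mod-square x d n
... | q , eq = (+ suc n) ℤ.* x ℤ.^ n ℤ.+ (x ℤ.+ d) ℤ.* q
             , trans (cong ((x ℤ.+ d) ℤ.*_) eq) (step x d (x ℤ.^ n) (+ suc n) q)
  where
  step : ∀ x d y c q →
    (x ℤ.+ d) ℤ.* (x ℤ.* y ℤ.+ c ℤ.* y ℤ.* d ℤ.+ q ℤ.* (d ℤ.* d))
      ≡ x ℤ.* (x ℤ.* y) ℤ.+ (+ 1 ℤ.+ c) ℤ.* (x ℤ.* y) ℤ.* d
          ℤ.+ (c ℤ.* y ℤ.+ (x ℤ.+ d) ℤ.* q) ℤ.* (d ℤ.* d)
  step = ℤ-Solver.solve-∀

odd-power-pair-expansion : ∀ k b j → let e = suc (2 * j); N = k + b in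
  ∃[ q ] + (k ^ e + b ^ e) ≡ + (N * e) ℤ.* (- + b) ℤ.^ (2 * j) ℤ.+ q ℤ.* + (N * N)
odd-power-pair-expansion k b j with binomial-mod-square (- + b) (+ (k + b)) (2 * j)
... | q , binomial = q , (begin
    + (k ^ e + b ^ e)
  ≡⟨ ℤ.pos-+ (k ^ e) (b ^ e) ⟩
    + (k ^ e) ℤ.+ + (b ^ e)
  ≡⟨ cong₂ ℤ._+_ (pos-^ k e) (pos-^ b e) ⟩
    (+ k) ℤ.^ e ℤ.+ y
  ≡⟨ cong (λ u → u ℤ.^ e ℤ.+ y) k≡x+N ⟩
    (x ℤ.+ N) ℤ.^ e ℤ.+ y
  ≡⟨ cong (ℤ._+ y) binomial ⟩
    (x ℤ.^ e ℤ.+ (+ e) ℤ.* x ℤ.^ (2 * j) ℤ.* N ℤ.+ q ℤ.* (N ℤ.* N)) ℤ.+ y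
  ≡⟨ cong (λ u → (u ℤ.+ (+ e) ℤ.* x ℤ.^ (2 * j) ℤ.* N ℤ.+ q ℤ.* (N ℤ.* N)) ℤ.+ y) (neg-^-odd (+ b) j) ⟩
    (- y ℤ.+ (+ e) ℤ.* x ℤ.^ (2 * j) ℤ.* N ℤ.+ q ℤ.* (N ℤ.* N)) ℤ.+ y
  ≡⟨ cancel y (+ e) (x ℤ.^ (2 * j)) N q ⟩
    (N ℤ.* + e) ℤ.* x ℤ.^ (2 * j) ℤ.+ q ℤ.* (N ℤ.* N)
  ≡⟨ cong₂ (λ u v → u ℤ.* x ℤ.^ (2 * j) ℤ.+ q ℤ.* v) (ℤ.pos-* (k + b) e) (ℤ.pos-* (k + b) (k + b)) ⟨
    + ((k + b) * e) ℤ.* x ℤ.^ (2 * j) ℤ.+ q ℤ.* + ((k + b) * (k + b))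
  ∎)
  where
  open ≡-Reasoning
  e : ℕ
  e = suc (2 * j)
  x y N : ℤ
  x = - + b
  y = (+ b) ℤ.^ e
  N = + (k + b)
  k≡x+N : + k ≡ x ℤ.+ N
  k≡x+N = trans (shift (+ k) (+ b)) (cong (λ u → x ℤ.+ u) (sym (ℤ.pos-+ k b)))
    where
    shift : ∀ k b → k ≡ - b ℤ.+ (k ℤ.+ b)
    shift = ℤ-Solver.solve-∀
  cancel : ∀ y E X N q → (- y ℤ.+ E ℤ.* X ℤ.* N ℤ.+ q ℤ.* (N ℤ.* N)) ℤ.+ y
                         ≡ (N ℤ.* E) ℤ.* X ℤ.+ q ℤ.* (N ℤ.* N)
  cancel = ℤ-Solver.solve-∀

pos-∣ : ∀ {m n} → m ∣ n → + m ℤ∣.∣ + n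
pos-∣ = ∣ᵤ⇒∣

∣-odd-power-pair : ∀ {d N e k b} → ¬ 2 ∣ e → k + b ≡ N →
                   d ∣ N * e → d ∣ N * N → d ∣ k ^ e + b ^ e
∣-odd-power-pair {d} {e = e} {k} {b} 2∤e refl d∣Ne d∣NN with odd⇒≡suc-2* e 2∤e
... | j , refl with odd-power-pair-expansion k b j
...   | q , expansion = ∣⇒∣ᵤ (subst (+ d ℤ∣.∣_) (sym expansion)
          (ℤ∣.∣m∣n⇒∣m+n (ℤ∣.∣m⇒∣m*n _ (pos-∣ d∣Ne)) (ℤ∣.∣n⇒∣m*n q (pos-∣ d∣NN))))

reflectedPowSum : ℕ → ℕ → ℕ → ℕ
reflectedPowSum e c zero    = 0
reflectedPowSum e c (suc n) = reflectedPowSum e c n + (c ∸ suc n) ^ e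

reflectedPowSum-suc : ∀ e c n → reflectedPowSum e (suc c) (suc n) ≡ c ^ e + reflectedPowSum e c n
reflectedPowSum-suc e c zero    = ℕ.+-comm 0 (c ^ e)
reflectedPowSum-suc e c (suc n) = trans (cong (_+ (c ∸ suc n) ^ e) (reflectedPowSum-suc e c n))
                                        (ℕ.+-assoc (c ^ e) (reflectedPowSum e c n) _)

reflectedPowSum-self : ∀ e n → reflectedPowSum e (suc n) n ≡ powSum e n
reflectedPowSum-self e zero    = refl
reflectedPowSum-self e (suc n) = begin
  reflectedPowSum e (suc (suc n)) (suc n)  ≡⟨ reflectedPowSum-suc e (suc n) n ⟩
  suc n ^ e + reflectedPowSum e (suc n) n  ≡⟨ ℕ.+-comm (suc n ^ e) _ ⟩
  reflectedPowSum e (suc n) n + suc n ^ e  ≡⟨ cong (_+ suc n ^ e) (reflectedPowSum-self e n) ⟩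
  powSum e n + suc n ^ e                   ∎
  where open ≡-Reasoning

∣-powSum+reflectedPowSum : ∀ {d e c} → (∀ k b → k + b ≡ c → d ∣ k ^ e + b ^ e) →
                           ∀ n → n ≤ c → d ∣ powSum e n + reflectedPowSum e c n
∣-powSum+reflectedPowSum pairs zero    _   = divides 0 refl
∣-powSum+reflectedPowSum {d} {e} {c} pairs (suc n) n<c =
  subst (d ∣_) (sym (interchange (powSum e n) (suc n ^ e) (reflectedPowSum e c n) ((c ∸ suc n) ^ e)))
    (∣m∣n⇒∣m+n (∣-powSum+reflectedPowSum pairs n (ℕ.<⇒≤ n<c))
               (pairs (suc n) (c ∸ suc n) (ℕ.m+[n∸m]≡n n<c)))
  where
  interchange : ∀ a b c d → a + b + (c + d) ≡ (a + c) + (b + d)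
  interchange = ℕ-Solver.solve-∀

∣-2*powSum : ∀ {d e} n → (∀ k b → k + b ≡ suc n → d ∣ k ^ e + b ^ e) → d ∣ 2 * powSum e n
∣-2*powSum {d} {e} n pairs = subst (d ∣_) doubled (∣-powSum+reflectedPowSum pairs n (ℕ.n≤1+n n))
  where
  doubled : powSum e n + reflectedPowSum e (suc n) n ≡ 2 * powSum e n
  doubled = cong (λ u → powSum e n + u) (trans (reflectedPowSum-self e n) (sym (ℕ.+-identityʳ _)))

powSum-pred-∣ : ∀ {d e N} → 1 ≤ N → ¬ 2 ∣ d → ¬ 2 ∣ e →
                d ∣ N * e → d ∣ N * N → d ∣ powSum e (N ∸ 1)
powSum-pred-∣ {N = suc n} _ 2∤d 2∤e d∣Ne d∣NN =
  coprime-divisor (odd⇒coprime-2 2∤d)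
    (∣-2*powSum n (λ k b k+b≡N → ∣-odd-power-pair 2∤e k+b≡N d∣Ne d∣NN))

powSum-∣ : ∀ {d e N} → 1 ≤ N → ¬ 2 ∣ d → ¬ 2 ∣ e → 2 ≤ e →
           d ∣ N * e → d ∣ N * N → d ∣ powSum e N
powSum-∣ {N = suc n} 1≤N 2∤d 2∤e 2≤e d∣Ne d∣NN =
  ∣m∣n⇒∣m+n (powSum-pred-∣ 1≤N 2∤d 2∤e d∣Ne d∣NN) (∣-trans d∣NN (m*m∣m^n (suc n) 2≤e))

proposition2p4 : (p m t : ℕ) → Prime p → 3 ≤ p → ¬ (2 ∣ m) → 1 ≤ t →
    (p ^ (t + 1) ∣ powSum (m * p) (p ^ t)) × (p ^ (t + 1) ∣ powSum (m * p) (p ^ t ∸ 1))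
proposition2p4 p zero t pp 3≤p 2∤0 _ = contradiction (divides 0 refl) 2∤0
proposition2p4 p m@(suc _) t@(suc t') pp 3≤p 2∤m _
  rewrite ℕ.^-distribˡ-+-* p t 1 | ℕ.^-identityʳ p
  = powSum-∣ 1≤N 2∤d 2∤e 2≤e d∣Ne d∣NN , powSum-pred-∣ 1≤N 2∤d 2∤e d∣Ne d∣NN
  where
  N : ℕ
  N = p ^ t
  2∤p : ¬ 2 ∣ p
  2∤p = prime≥3⇒odd pp 3≤p
  1≤N : 1 ≤ N
  1≤N = ℕ.m^n>0 p {{prime⇒nonZero pp}} t
  2∤d : ¬ 2 ∣ N * p
  2∤d = prime∤-* prime[2] (prime∤-^ prime[2] 2∤p t) 2∤p
  2∤e : ¬ 2 ∣ m * p
  2∤e = prime∤-* prime[2] 2∤m 2∤p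
  2≤e : 2 ≤ m * p
  2≤e = ℕ.≤-trans (ℕ.≤-trans (s≤s (s≤s z≤n)) 3≤p) (ℕ.m≤m+n p _)
  d∣Ne : N * p ∣ N * (m * p)
  d∣Ne = *-monoʳ-∣ N (n∣m*n m)
  d∣NN : N * p ∣ N * N
  d∣NN = *-monoʳ-∣ N (m∣m*n (p ^ t'))
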